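{- Let $n\ge 1$ be an integer and let $A\subseteq\mathbb{Z}_5^n$ be sum-free. If $|A|>\frac32\cdot5^{n-1}$ and $A$ is contained in a union of two cosets of a proper subgroup $H<\mathbb{Z}_5^n$, then there is an element $e\notin H$ such that $A\subseteq(e+H)\cup(-e+H)$.
   Context: $\mathbb{Z}_5^n$ denotes the elementary abelian $5$-group of rank $n$. A subset $S$ of an abelian group is sum-free if there are no $x,y,z\in S$ (not necessarily distinct) with $x+y=z$. -}

module Defs where

open import Data.Nat using (ℕ; _+_; _∸_)
open import Data.Nat.DivMod using (_mod_)
open import Data.Fin using (Fin; toℕ)
open import Data.Vec using (Vec; zipWith; map; replicate)
open import Data.Sum using (_⊎_)
open import Data.Product using (∃)
open import Relation.Nullary using (¬_)
open import Relation.Binary.PropositionalEquality using (_≡_)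

_+₅_ : Fin 5 → Fin 5 → Fin 5
x +₅ y = (toℕ x + toℕ y) mod 5

-₅_ : Fin 5 → Fin 5
-₅ x = (5 ∸ toℕ x) mod 5

Z5 : ℕ → Set
Z5 n = Vec (Fin 5) n

_⊕_ : ∀ {n} → Z5 n → Z5 n → Z5 n
_⊕_ = zipWith _+₅_

⊖_ : ∀ {n} → Z5 n → Z5 n
⊖_ = map -₅_

𝟘 : ∀ {n} → Z5 n
𝟘 = replicate _ Data.Fin.zero

record IsSubgroup {n : ℕ} (H : Z5 n → Set) : Set where
  field
    has-zero : H 𝟘
    +-closed : ∀ x y → H x → H y → H (x ⊕ y)
    neg-closed : ∀ x → H x → H (⊖ x)

IsProper : {n : ℕ} → (Z5 n → Set) → Set
IsProper {n} H = ∃ λ (x : Z5 n) → ¬ H x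

InCoset : {n : ℕ} → (Z5 n → Set) → Z5 n → Z5 n → Set
InCoset H a x = H (x ⊕ (⊖ a))

module Submission where

-- Put X = A ∩ (a + H) and Y = A ∖ X ⊆ b + H. Sum-freeness gives the key bound: if z ∈ A lies in
-- u + v + H, then any X′ ⊆ A ∩ (u + H) and the translate z − Y′ of any Y′ ⊆ A ∩ (v + H) are
-- disjoint subsets of u + H, so ∣X′∣ + ∣Y′∣ ≤ ∣H∣. As H is proper, ∣H∣ ≤ 5ⁿ⁻¹ < (2/3)∣A∣ while
-- ∣X∣, ∣Y∣ ≤ ∣H∣, so X and Y each have more than ∣H∣/2 elements and no element of A lies in
-- 2a + H. In particular a ∉ H, and an element c ∈ A outside ±a + H would avoid every coset
-- k·a + H (k ∈ ℤ₅). Then H, a and c generate a subgroup of order 25∣H∣ ≤ 5ⁿ, which is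
-- incompatible with ∣A∣ ≤ ∣X∣ + ∣Y∣ ≤ 2∣H∣.

open import Defs
open import Data.Fin using (Fin; toℕ) renaming (zero to fz; suc to fs)
open import Level using (0ℓ)
open import Relation.Binary.PropositionalEquality
  using (_≡_; _≢_; refl; sym; trans; cong; cong₂; subst; module ≡-Reasoning)
open import Algebra.Bundles using (AbelianGroup)
open import Algebra.Definitions {A = Fin 5} _≡_
  using (Associative; Commutative; Identity; Inverse)
import Algebra.Properties.AbelianGroup as AbelianGroupProperties
import Algebra.Properties.CommutativeSemigroup as CommutativeSemigroupProperties
import Algebra.Properties.Group as GroupProperties
import Algebra.Properties.Monoid.Mult as MonoidMultiplication
open import Data.Fin.Properties using (all?; any?; _≟_; toℕ-injective; toℕ<n; toℕ-fromℕ<)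
open import Data.Nat using (ℕ; zero; suc; _*_; _+_; _^_; _≤_; _<_; _∸_; z≤n; s≤s)
open import Data.Nat.DivMod using (_%_; _/_; _mod_; m%n<n; m≡m%n+[m/n]*n)
open import Data.Nat.Properties
  using ( +-suc; +-comm; +-identityʳ; +-cancelʳ-<; +-mono-≤; +-monoʳ-≤; *-comm; *-mono-≤
        ; *-monoʳ-≤; *-cancelˡ-≤; *-distribˡ-+; m≤m+n; m∸n≤m; m∸n+n≡m; m∸n≡0⇒m≤n
        ; <-irrefl; ≤⇒≯; ≤-trans; ≤-<-trans; ≤-total; ≤-antisym; module ≤-Reasoning)
open import Data.Vec using ([]; _∷_)
open import Data.Vec.Properties
  using ( ∷-injective; zipWith-assoc; zipWith-comm; zipWith-identityˡ; zipWith-identityʳ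
        ; zipWith-inverseˡ; zipWith-inverseʳ)
open import Data.List using (List; []; _∷_; [_]; _++_; length; map; filter; cartesianProductWith; allFin)
open import Data.List.Properties using (length-++; length-map; length-filter)
open import Data.List.Membership.Propositional using (_∈_)
open import Data.List.Membership.Propositional.Properties
  using ( ∈-++⁻; ∈-filter⁺; ∈-filter⁻; ∈-map⁻; ∈-allFin
        ; ∈-cartesianProductWith⁺; ∈-cartesianProductWith⁻)
open import Data.List.Relation.Binary.Subset.Propositional using (_⊆_)
open import Data.List.Relation.Unary.Any using (here; there)
open import Data.List.Relation.Unary.All as All using ([])
open import Data.List.Relation.Unary.AllPairs using ([]; _∷_)
open import Data.List.Relation.Unary.Unique.Propositional using (Unique)
open import Data.List.Relation.Unary.Unique.Propositional.Properties
  using (cartesianProductWith⁺; allFin⁺; filter⁺; map⁺; ++⁺)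
open import Data.Product using (∃; _×_; _,_; proj₁; proj₂)
open import Data.Sum using (_⊎_; inj₁; inj₂)
open import Data.Empty using (⊥; ⊥-elim)
open import Relation.Nullary using (Dec; ¬_; yes; no)
open import Relation.Unary using (Decidable)
open import Relation.Unary.Properties using (∁?)
open import Relation.Nullary.Decidable using (True; toWitness)
open import Relation.Binary.PropositionalEquality.Algebra using (isMagma)
open import Relation.Binary.Bundles using (Setoid)
import Relation.Binary.Reasoning.Setoid as SetoidReasoning

-- ℤ₅ⁿ as an abelian group

-- ℤ₅ is small enough for its laws to be checked by evaluating every case.
by-evaluation : {P : Set} (P? : Dec P) → {True P?} → P
by-evaluation _ {p} = toWitness p

+₅-assoc : Associative _+₅_
+₅-assoc = by-evaluation (all? λ x → all? λ y → all? λ z → (x +₅ y) +₅ z ≟ x +₅ (y +₅ z))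

+₅-comm : Commutative _+₅_
+₅-comm = by-evaluation (all? λ x → all? λ y → x +₅ y ≟ y +₅ x)

+₅-identity : Identity fz _+₅_
+₅-identity = by-evaluation (all? λ x → fz +₅ x ≟ x) , by-evaluation (all? λ x → x +₅ fz ≟ x)

-₅‿inverse : Inverse fz -₅_ _+₅_
-₅‿inverse = by-evaluation (all? λ x → (-₅ x) +₅ x ≟ fz) , by-evaluation (all? λ x → x +₅ (-₅ x) ≟ fz)

ℤ₅ⁿ : ℕ → AbelianGroup 0ℓ 0ℓ
ℤ₅ⁿ n = record
  { Carrier = Z5 n
  ; _≈_ = _≡_
  ; _∙_ = _⊕_
  ; ε = 𝟘
  ; _⁻¹ = ⊖_
  ; isAbelianGroup = record
    { isGroup = record
      { isMonoid = record
        { isSemigroup = record { isMagma = isMagma _⊕_ ; assoc = zipWith-assoc +₅-assoc }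
        ; identity = zipWith-identityˡ (proj₁ +₅-identity) , zipWith-identityʳ (proj₂ +₅-identity)
        }
      ; inverse = zipWith-inverseˡ (proj₁ -₅‿inverse) , zipWith-inverseʳ (proj₂ -₅‿inverse)
      ; ⁻¹-cong = cong ⊖_
      }
    ; comm = zipWith-comm +₅-comm
    }
  }

module _ {c ℓ} (G : AbelianGroup c ℓ) where
  open AbelianGroup G
  open GroupProperties group using (//-rightDividesˡ)
  open AbelianGroupProperties G using (⁻¹-∙-comm)
  open CommutativeSemigroupProperties commutativeSemigroup using (interchange)
  open import Relation.Binary.Reasoning.Setoid setoid

  -‿telescope : ∀ x y z → (x - y) ∙ (y - z) ≈ x - z
  -‿telescope x y z = begin
    (x - y) ∙ (y - z)     ≈⟨ assoc (x - y) y (z ⁻¹) ⟨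
    ((x - y) ∙ y) ∙ z ⁻¹  ≈⟨ ∙-congʳ (//-rightDividesˡ y x) ⟩
    x - z                 ∎

  -‿interchange : ∀ x y u v → (x ∙ u) - (y ∙ v) ≈ (x - y) ∙ (u - v)
  -‿interchange x y u v = begin
    (x ∙ u) ∙ (y ∙ v) ⁻¹    ≈⟨ ∙-congˡ (⁻¹-∙-comm y v) ⟨
    (x ∙ u) ∙ (y ⁻¹ ∙ v ⁻¹) ≈⟨ interchange x u (y ⁻¹) (v ⁻¹) ⟩
    (x - y) ∙ (u - v)       ∎

infixr 25 _·_
_·_ : ∀ {n} → ℕ → Z5 n → Z5 n
_·_ {n} = MonoidMultiplication._×_ (AbelianGroup.monoid (ℤ₅ⁿ n))

·-exponent : ∀ {n} (x : Z5 n) → 5 · x ≡ 𝟘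
·-exponent [] = refl
·-exponent (x ∷ xs) = cong₂ _∷_ (+₅-exponent x) (·-exponent xs)
  where
  +₅-exponent : ∀ x → x +₅ (x +₅ (x +₅ (x +₅ (x +₅ fz)))) ≡ fz
  +₅-exponent = by-evaluation (all? λ x → x +₅ (x +₅ (x +₅ (x +₅ (x +₅ fz)))) ≟ fz)

module _ {n : ℕ} where
  open AbelianGroup (ℤ₅ⁿ n) using (identityʳ)
  open GroupProperties (AbelianGroup.group (ℤ₅ⁿ n)) using (inverseʳ-unique)
  open MonoidMultiplication (AbelianGroup.monoid (ℤ₅ⁿ n)) using (×-homo-+; ×-assocˡ)
  open ≡-Reasoning

  ⊖≡4· : ∀ (x : Z5 n) → ⊖ x ≡ 4 · x
  ⊖≡4· x = sym (inverseʳ-unique x (4 · x) (·-exponent x))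

  ·-mod-5 : ∀ m (x : Z5 n) → toℕ (m mod 5) · x ≡ m · x
  ·-mod-5 m x = begin
    toℕ (m mod 5) · x                  ≡⟨ cong (_· x) (toℕ-fromℕ< (m%n<n m 5)) ⟩
    (m % 5) · x                        ≡⟨ identityʳ _ ⟨
    (m % 5) · x ⊕ 𝟘                     ≡⟨ cong ((m % 5) · x ⊕_) (·-exponent ((m / 5) · x)) ⟨
    (m % 5) · x ⊕ 5 · (m / 5) · x       ≡⟨ cong ((m % 5) · x ⊕_) (×-assocˡ x 5 (m / 5)) ⟩
    (m % 5) · x ⊕ (5 * (m / 5)) · x     ≡⟨ ×-homo-+ x (m % 5) (5 * (m / 5)) ⟨
    (m % 5 + 5 * (m / 5)) · x           ≡⟨ cong (λ k → (m % 5 + k) · x) (*-comm 5 (m / 5)) ⟩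
    (m % 5 + (m / 5) * 5) · x           ≡⟨ cong (_· x) (m≡m%n+[m/n]*n m 5) ⟨
    m · x                              ∎

  ·-inverse : ∀ i d (x : Z5 n) → toℕ ((i * d) mod 5) ≡ 1 → i · d · x ≡ x
  ·-inverse i d x id≡1 = begin
    i · d · x                   ≡⟨ ×-assocˡ x i d ⟩
    (i * d) · x                 ≡⟨ ·-mod-5 (i * d) x ⟨
    toℕ ((i * d) mod 5) · x     ≡⟨ cong (_· x) id≡1 ⟩
    1 · x                       ≡⟨ identityʳ x ⟩
    x                           ∎

-- Counting in ℤ₅ⁿ

module _ {A : Set} where
  private
    ∈-delete : ∀ {x : A} {ys} → x ∈ ys →
               ∃ λ zs → length ys ≡ suc (length zs) × (∀ {y} → y ∈ ys → y ≢ x → y ∈ zs)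
    ∈-delete {ys = _ ∷ ys} (here refl) = ys , refl , λ where
      (here refl) y≢x → ⊥-elim (y≢x refl)
      (there y∈ys) _  → y∈ys
    ∈-delete {ys = z ∷ ys} (there x∈ys) with ∈-delete x∈ys
    ... | zs , len , ⊆zs = z ∷ zs , cong suc len , λ where
      (here refl) _    → here refl
      (there y∈ys) y≢x → there (⊆zs y∈ys y≢x)

  Unique-⊆⇒length≤ : ∀ {xs ys : List A} → Unique xs → xs ⊆ ys → length xs ≤ length ys
  Unique-⊆⇒length≤ [] _ = z≤n
  Unique-⊆⇒length≤ (x∉xs ∷ xs!) xs⊆ys with ∈-delete (xs⊆ys (here refl))
  ... | zs , len , ⊆zs = subst (_ ≤_) (sym len)
    (s≤s (Unique-⊆⇒length≤ xs! λ y∈xs →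
      ⊆zs (xs⊆ys (there y∈xs)) λ { refl → All.lookup x∉xs y∈xs refl }))

  <2*length⇒∃∈ : ∀ {k} (xs : List A) → k < 2 * length xs → ∃ (_∈ xs)
  <2*length⇒∃∈ []      ()
  <2*length⇒∃∈ (x ∷ _) _ = x , here refl

  length-filter-∁ : ∀ {P : A → Set} (P? : Decidable P) xs →
                    length (filter P? xs) + length (filter (∁? P?) xs) ≡ length xs
  length-filter-∁ P? [] = refl
  length-filter-∁ P? (x ∷ xs) with P? x
  ... | yes _ = cong suc (length-filter-∁ P? xs)
  ... | no _  = trans (+-suc _ _) (cong suc (length-filter-∁ P? xs))

length-cartesianProductWith : ∀ {A B C : Set} (f : A → B → C) xs ys →
                              length (cartesianProductWith f xs ys) ≡ length xs * length ys
length-cartesianProductWith f [] ys = refl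
length-cartesianProductWith f (x ∷ xs) ys = begin
  length (map (f x) ys ++ cartesianProductWith f xs ys)
    ≡⟨ length-++ (map (f x) ys) ⟩
  length (map (f x) ys) + length (cartesianProductWith f xs ys)
    ≡⟨ cong₂ _+_ (length-map (f x) ys) (length-cartesianProductWith f xs ys) ⟩
  length ys + length xs * length ys
    ∎
  where open ≡-Reasoning

enumerate : ∀ n → List (Z5 n)
enumerate zero    = [ [] ]
enumerate (suc n) = cartesianProductWith _∷_ (allFin 5) (enumerate n)

∈-enumerate : ∀ {n} (x : Z5 n) → x ∈ enumerate n
∈-enumerate []       = here refl
∈-enumerate (x ∷ xs) = ∈-cartesianProductWith⁺ _∷_ (∈-allFin x) (∈-enumerate xs)

enumerate-unique : ∀ n → Unique (enumerate n)
enumerate-unique zero    = [] ∷ []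
enumerate-unique (suc n) = cartesianProductWith⁺ _∷_ ∷-injective (allFin⁺ 5) (enumerate-unique n)

length-enumerate : ∀ n → length (enumerate n) ≡ 5 ^ n
length-enumerate zero    = refl
length-enumerate (suc n) = trans (length-cartesianProductWith _∷_ (allFin 5) (enumerate n))
                                 (cong (5 *_) (length-enumerate n))

∣_∣ : ∀ {n} {P : Z5 n → Set} → Decidable P → ℕ
∣_∣ {n} P? = length (filter P? (enumerate n))

module _ {n : ℕ} {P : Z5 n → Set} (P? : Decidable P) where

  ∣∣≤5^n : ∣ P? ∣ ≤ 5 ^ n
  ∣∣≤5^n = subst (∣ P? ∣ ≤_) (length-enumerate n) (length-filter P? (enumerate n))

  Unique⇒length≤∣∣ : ∀ {xs} → Unique xs → (∀ {x} → x ∈ xs → P x) → length xs ≤ ∣ P? ∣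
  Unique⇒length≤∣∣ xs! xs⊆P =
    Unique-⊆⇒length≤ xs! λ {x} x∈xs → ∈-filter⁺ P? (∈-enumerate x) (xs⊆P x∈xs)

-- Cosets of a subgroup

infix 5 _+⟨_⟩
_+⟨_⟩ : ∀ {n} → (Z5 n → Set) → Z5 n → Z5 n → Set
(H +⟨ g ⟩) x = ∃ λ (k : Fin 5) → InCoset H (toℕ k · g) x

module Coset {n : ℕ} {H : Z5 n → Set} (H? : Decidable H) (H-sub : IsSubgroup H) where
  open IsSubgroup H-sub
  open AbelianGroup (ℤ₅ⁿ n) using (_-_; comm; identityʳ; inverseʳ)
  open GroupProperties (AbelianGroup.group (ℤ₅ⁿ n)) using (//-rightDividesʳ; ∙-cancelˡ; ∙-cancelʳ)
  open AbelianGroupProperties (ℤ₅ⁿ n) using (⁻¹-anti-homo‿-; ⁻¹-∙-comm)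
  open MonoidMultiplication (AbelianGroup.monoid (ℤ₅ⁿ n)) using (×-homo-+; ×-assocˡ)

  infix 4 _∼_
  _∼_ : Z5 n → Z5 n → Set
  x ∼ y = InCoset H y x

  _∼?_ : ∀ x y → Dec (x ∼ y)
  x ∼? y = H? (x - y)

  ∼-refl : ∀ {x} → x ∼ x
  ∼-refl {x} = subst H (sym (inverseʳ x)) has-zero

  ∼-sym : ∀ {x y} → x ∼ y → y ∼ x
  ∼-sym {x} {y} x∼y = subst H (⁻¹-anti-homo‿- x y) (neg-closed _ x∼y)

  ∼-trans : ∀ {x y z} → x ∼ y → y ∼ z → x ∼ z
  ∼-trans {x} {y} {z} x∼y y∼z = subst H (-‿telescope (ℤ₅ⁿ n) x y z) (+-closed _ _ x∼y y∼z)

  ⊕-cong : ∀ {x y u v} → x ∼ y → u ∼ v → (x ⊕ u) ∼ (y ⊕ v)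
  ⊕-cong {x} {y} {u} {v} x∼y u∼v =
    subst H (sym (-‿interchange (ℤ₅ⁿ n) x y u v)) (+-closed _ _ x∼y u∼v)

  ⊖-cong : ∀ {x y} → x ∼ y → (⊖ x) ∼ (⊖ y)
  ⊖-cong {x} {y} x∼y = subst H (sym (⁻¹-∙-comm x (⊖ y))) (neg-closed _ x∼y)

  ∼-setoid : Setoid 0ℓ 0ℓ
  ∼-setoid = record
    { Carrier = Z5 n
    ; _≈_ = _∼_
    ; isEquivalence = record { refl = ∼-refl ; sym = ∼-sym ; trans = ∼-trans }
    }

  module ∼-Reasoning = SetoidReasoning ∼-setoid

  ∈⇒+∼ : ∀ {x y} → H y → (x ⊕ y) ∼ x
  ∈⇒+∼ {x} {y} Hy = subst H (sym (trans (cong (_- x) (comm x y)) (//-rightDividesʳ x y))) Hy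

  ·-closed : ∀ k {x} → H x → H (k · x)
  ·-closed zero    Hx = has-zero
  ·-closed (suc k) Hx = +-closed _ _ Hx (·-closed k Hx)

  -- Each d ∈ {1,2,3,4} has an inverse i modulo 5, and i · d · g = g.
  small-multiple∈⇒0 : ∀ {g} d → d < 5 → H (d · g) → ¬ H g → d ≡ 0
  small-multiple∈⇒0 0 _ _ _ = refl
  small-multiple∈⇒0 {g} 1 _ Hdg g∉H = ⊥-elim (g∉H (subst H (identityʳ g) Hdg))
  small-multiple∈⇒0 {g} 2 _ Hdg g∉H = ⊥-elim (g∉H (subst H (·-inverse 3 2 g refl) (·-closed 3 Hdg)))
  small-multiple∈⇒0 {g} 3 _ Hdg g∉H = ⊥-elim (g∉H (subst H (·-inverse 2 3 g refl) (·-closed 2 Hdg)))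
  small-multiple∈⇒0 {g} 4 _ Hdg g∉H = ⊥-elim (g∉H (subst H (·-inverse 4 4 g refl) (·-closed 4 Hdg)))
  small-multiple∈⇒0 (suc (suc (suc (suc (suc _))))) (s≤s (s≤s (s≤s (s≤s (s≤s ()))))) _ _

  private
    descending-multiples-distinct : ∀ {g} → ¬ H g → ∀ j k → toℕ k ≤ toℕ j →
                                    toℕ j · g ∼ toℕ k · g → j ≡ k
    descending-multiples-distinct {g} g∉H j k k≤j jg∼kg =
      toℕ-injective (≤-antisym (m∸n≡0⇒m≤n (small-multiple∈⇒0 d d<5 Hdg g∉H)) k≤j)
      where
      open ≡-Reasoning
      d = toℕ j ∸ toℕ k
      d<5 : d < 5
      d<5 = ≤-<-trans (m∸n≤m (toℕ j) (toℕ k)) (toℕ<n j)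
      Hdg : H (d · g)
      Hdg = subst H (begin
        toℕ j · g - toℕ k · g              ≡⟨ cong (λ m → m · g - toℕ k · g) (m∸n+n≡m k≤j) ⟨
        (d + toℕ k) · g - toℕ k · g        ≡⟨ cong (_- toℕ k · g) (×-homo-+ g d (toℕ k)) ⟩
        (d · g ⊕ toℕ k · g) - toℕ k · g    ≡⟨ //-rightDividesʳ (toℕ k · g) (d · g) ⟩
        d · g                              ∎) jg∼kg

  multiples-distinct : ∀ {g} → ¬ H g → ∀ j k → toℕ j · g ∼ toℕ k · g → j ≡ k
  multiples-distinct g∉H j k jg∼kg with ≤-total (toℕ j) (toℕ k)
  ... | inj₁ j≤k = sym (descending-multiples-distinct g∉H k j j≤k (∼-sym jg∼kg))
  ... | inj₂ k≤j = descending-multiples-distinct g∉H j k k≤j jg∼kg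

  +⟨_⟩? : ∀ g → Decidable (H +⟨ g ⟩)
  +⟨ g ⟩? x = any? λ k → x ∼? (toℕ k · g)

  +⟨_⟩-isSubgroup : ∀ g → IsSubgroup (H +⟨ g ⟩)
  +⟨ g ⟩-isSubgroup = record
    { has-zero   = fz , ∼-refl
    ; +-closed   = λ { x y (j , x∼jg) (k , y∼kg) → (toℕ j + toℕ k) mod 5 , (begin
        x ⊕ y                           ≈⟨ ⊕-cong x∼jg y∼kg ⟩
        toℕ j · g ⊕ toℕ k · g           ≡⟨ ×-homo-+ g (toℕ j) (toℕ k) ⟨
        (toℕ j + toℕ k) · g             ≡⟨ ·-mod-5 (toℕ j + toℕ k) g ⟨
        toℕ ((toℕ j + toℕ k) mod 5) · g ∎) }
    ; neg-closed = λ { x (k , x∼kg) → (4 * toℕ k) mod 5 , (begin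
        ⊖ x                             ≈⟨ ⊖-cong x∼kg ⟩
        ⊖ (toℕ k · g)                   ≡⟨ ⊖≡4· (toℕ k · g) ⟩
        4 · toℕ k · g                   ≡⟨ ×-assocˡ g 4 (toℕ k) ⟩
        (4 * toℕ k) · g                 ≡⟨ ·-mod-5 (4 * toℕ k) g ⟨
        toℕ ((4 * toℕ k) mod 5) · g     ∎) }
    }
    where open ∼-Reasoning

  private
    Hs : List (Z5 n)
    Hs = filter H? (enumerate n)

    Hs⊆H : ∀ {y} → y ∈ Hs → H y
    Hs⊆H y∈Hs = proj₂ (∈-filter⁻ H? {xs = enumerate n} y∈Hs)

    shift : Z5 n → Fin 5 → Z5 n → Z5 n
    shift g k y = toℕ k · g ⊕ y

    shifts-unique : ∀ {g} → ¬ H g → ∀ {ks} → Unique ks →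
                    Unique (cartesianProductWith (shift g) ks Hs)
    shifts-unique g∉H [] = []
    shifts-unique {g} g∉H {k ∷ ks} (k∉ks ∷ ks!) =
      ++⁺ (map⁺ (∙-cancelˡ _ _ _) (filter⁺ H? (enumerate-unique n))) (shifts-unique g∉H ks!) disjoint
      where
      disjoint : ∀ {v} → ¬ (v ∈ map (shift g k) Hs × v ∈ cartesianProductWith (shift g) ks Hs)
      disjoint (v∈k+H , v∈ks+H)
        with ∈-map⁻ (shift g k) v∈k+H | ∈-cartesianProductWith⁻ (shift g) ks Hs v∈ks+H
      ... | y , y∈H , refl | k′ , z , k′∈ks , z∈H , kg+y≡k′g+z =
        All.lookup k∉ks k′∈ks (multiples-distinct g∉H k k′ (begin
          toℕ k · g         ≈⟨ ∈⇒+∼ (Hs⊆H y∈H) ⟨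
          toℕ k · g ⊕ y     ≡⟨ kg+y≡k′g+z ⟩
          toℕ k′ · g ⊕ z    ≈⟨ ∈⇒+∼ (Hs⊆H z∈H) ⟩
          toℕ k′ · g        ∎))
        where open ∼-Reasoning

  -- The five cosets k · g + H (k < 5) are disjoint and lie in H +⟨ g ⟩.
  +⟨⟩-size : ∀ {g} → ¬ H g → 5 * ∣ H? ∣ ≤ ∣ +⟨ g ⟩? ∣
  +⟨⟩-size {g} g∉H =
    subst (_≤ ∣ +⟨ g ⟩? ∣) (length-cartesianProductWith (shift g) (allFin 5) Hs)
      (Unique⇒length≤∣∣ +⟨ g ⟩? (shifts-unique g∉H (allFin⁺ 5)) in-+⟨g⟩)
    where
    in-+⟨g⟩ : ∀ {v} → v ∈ cartesianProductWith (shift g) (allFin 5) Hs → (H +⟨ g ⟩) v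
    in-+⟨g⟩ v∈ with ∈-cartesianProductWith⁻ (shift g) (allFin 5) Hs v∈
    ... | k , y , _ , y∈H , refl = k , ∈⇒+∼ (Hs⊆H y∈H)

  proper⇒5∣∣≤5^n : ∀ {g} → ¬ H g → 5 * ∣ H? ∣ ≤ 5 ^ n
  proper⇒5∣∣≤5^n g∉H = ≤-trans (+⟨⟩-size g∉H) (∣∣≤5^n (+⟨ _ ⟩?))

  coset-length≤ : ∀ {xs u} → Unique xs → (∀ {x} → x ∈ xs → x ∼ u) → length xs ≤ ∣ H? ∣
  coset-length≤ {xs} {u} xs! xs∼u =
    subst (_≤ ∣ H? ∣) (length-map (_- u) xs)
      (Unique⇒length≤∣∣ H? (map⁺ (∙-cancelʳ _ _ _) xs!) in-H)
    where
    in-H : ∀ {v} → v ∈ map (_- u) xs → H v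
    in-H v∈ with ∈-map⁻ (_- u) v∈
    ... | x , x∈xs , refl = xs∼u x∈xs

-- Sum-free sets meeting cosets

module SumFree {n : ℕ} {H : Z5 n → Set} (H? : Decidable H) (H-sub : IsSubgroup H)
               {A : List (Z5 n)} (sum-free : ∀ x y z → x ∈ A → y ∈ A → z ∈ A → x ⊕ y ≢ z) where
  open Coset H? H-sub
  open AbelianGroup (ℤ₅ⁿ n) using (_-_)
  open GroupProperties (AbelianGroup.group (ℤ₅ⁿ n))
    using (//-rightDividesˡ; //-rightDividesʳ; ∙-cancelˡ; ⁻¹-injective)

  -- X and z - Y are disjoint subsets of the coset u + H.
  sum-free-coset-bound : ∀ {X Y u v z} → Unique X → Unique Y → X ⊆ A → Y ⊆ A →
                         (∀ {x} → x ∈ X → x ∼ u) → (∀ {y} → y ∈ Y → y ∼ v) →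
                         z ∈ A → z ∼ u ⊕ v → length X + length Y ≤ ∣ H? ∣
  sum-free-coset-bound {X} {Y} {u} {v} {z} X! Y! X⊆A Y⊆A X∼u Y∼v z∈A z∼u+v =
    subst (_≤ ∣ H? ∣) (trans (length-++ X) (cong (length X +_) (length-map (z -_) Y)))
      (coset-length≤ (++⁺ X! (map⁺ (λ eq → ⁻¹-injective (∙-cancelˡ z _ _ eq)) Y!) disjoint) in-u+H)
    where
    disjoint : ∀ {w} → ¬ (w ∈ X × w ∈ map (z -_) Y)
    disjoint (w∈X , w∈z-Y) with ∈-map⁻ (z -_) w∈z-Y
    ... | y , y∈Y , refl = sum-free (z - y) y z (X⊆A w∈X) (Y⊆A y∈Y) z∈A (//-rightDividesˡ y z)

    in-u+H : ∀ {w} → w ∈ X ++ map (z -_) Y → w ∼ u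
    in-u+H w∈ with ∈-++⁻ X w∈
    ... | inj₁ w∈X = X∼u w∈X
    ... | inj₂ w∈z-Y with ∈-map⁻ (z -_) w∈z-Y
    ...   | y , y∈Y , refl = begin
      z - y          ≈⟨ ⊕-cong z∼u+v (⊖-cong (Y∼v y∈Y)) ⟩
      (u ⊕ v) - v    ≡⟨ //-rightDividesʳ v u ⟩
      u              ∎
      where open ∼-Reasoning

  large-coset⇒no-double : ∀ {X u z} → Unique X → X ⊆ A → (∀ {x} → x ∈ X → x ∼ u) →
                          ∣ H? ∣ < 2 * length X → z ∈ A → ¬ z ∼ u ⊕ u
  large-coset⇒no-double {X} X! X⊆A X∼u large z∈A z∼2u =
    ≤⇒≯ (subst (_≤ ∣ H? ∣) (cong (length X +_) (sym (+-identityʳ (length X))))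
           (sum-free-coset-bound X! X! X⊆A X⊆A X∼u X∼u z∈A z∼2u)) large

module _ {h M a x y : ℕ} (3M<2a : 3 * M < 2 * a) (x+y≡a : x + y ≡ a) where
  open ≤-Reasoning

  part-exceeds-half : h ≤ M → y ≤ h → h < 2 * x
  part-exceeds-half h≤M y≤h = +-cancelʳ-< (2 * h) h (2 * x) (begin-strict
    3 * h            ≤⟨ *-monoʳ-≤ 3 h≤M ⟩
    3 * M            <⟨ 3M<2a ⟩
    2 * a            ≡⟨ cong (2 *_) x+y≡a ⟨
    2 * (x + y)      ≡⟨ *-distribˡ-+ 2 x y ⟩
    2 * x + 2 * y    ≤⟨ +-monoʳ-≤ (2 * x) (*-monoʳ-≤ 2 y≤h) ⟩
    2 * x + 2 * h    ∎)

  parts-exceed-fifth : 5 * h ≤ M → x ≤ h → y ≤ h → ⊥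
  parts-exceed-fifth 5h≤M x≤h y≤h = <-irrefl refl (begin-strict
    2 * a            ≡⟨ cong (2 *_) x+y≡a ⟨
    2 * (x + y)      ≤⟨ *-mono-≤ (s≤s (s≤s (z≤n {1}))) (+-mono-≤ x≤h (≤-trans y≤h (m≤m+n h (3 * h)))) ⟩
    3 * (h + 4 * h)  ≤⟨ *-monoʳ-≤ 3 5h≤M ⟩
    3 * M            <⟨ 3M<2a ⟩
    2 * a            ∎)

module TwoCosets {m : ℕ} {A : List (Z5 (suc m))} (A! : Unique A)
                 (sum-free : ∀ x y z → x ∈ A → y ∈ A → z ∈ A → x ⊕ y ≢ z)
                 (A-large : 3 * 5 ^ m < 2 * length A)
                 {H : Z5 (suc m) → Set} (H? : Decidable H) (H-sub : IsSubgroup H)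
                 {g₀ : Z5 (suc m)} (g₀∉H : ¬ H g₀)
                 {a b : Z5 (suc m)} (cover : ∀ x → x ∈ A → InCoset H a x ⊎ InCoset H b x) where
  open Coset H? H-sub
  open SumFree H? H-sub sum-free
  open AbelianGroup (ℤ₅ⁿ (suc m)) using (identityˡ; identityʳ)
  open MonoidMultiplication (AbelianGroup.monoid (ℤ₅ⁿ (suc m))) using (×-homo-+)

  X Y : List (Z5 (suc m))
  X = filter (_∼? a) A
  Y = filter (∁? (_∼? a)) A

  X! : Unique X
  X! = filter⁺ (_∼? a) A!

  Y! : Unique Y
  Y! = filter⁺ (∁? (_∼? a)) A!

  X⊆A : X ⊆ A
  X⊆A x∈X = proj₁ (∈-filter⁻ (_∼? a) {xs = A} x∈X)

  Y⊆A : Y ⊆ A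
  Y⊆A y∈Y = proj₁ (∈-filter⁻ (∁? (_∼? a)) {xs = A} y∈Y)

  X∼a : ∀ {x} → x ∈ X → x ∼ a
  X∼a x∈X = proj₂ (∈-filter⁻ (_∼? a) {xs = A} x∈X)

  Y∼b : ∀ {y} → y ∈ Y → y ∼ b
  Y∼b {y} y∈Y with ∈-filter⁻ (∁? (_∼? a)) {xs = A} y∈Y
  ... | y∈A , y≁a with cover y y∈A
  ...   | inj₁ y∼a = ⊥-elim (y≁a y∼a)
  ...   | inj₂ y∼b = y∼b

  ∣X∣+∣Y∣≡∣A∣ : length X + length Y ≡ length A
  ∣X∣+∣Y∣≡∣A∣ = length-filter-∁ (_∼? a) A

  ∣H∣≤5^m : ∣ H? ∣ ≤ 5 ^ m
  ∣H∣≤5^m = *-cancelˡ-≤ 5 (proper⇒5∣∣≤5^n g₀∉H)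

  X-large : ∣ H? ∣ < 2 * length X
  X-large = part-exceeds-half A-large ∣X∣+∣Y∣≡∣A∣ ∣H∣≤5^m (coset-length≤ Y! Y∼b)

  Y-large : ∣ H? ∣ < 2 * length Y
  Y-large = part-exceeds-half {x = length Y} {y = length X} A-large
              (trans (+-comm (length Y) (length X)) ∣X∣+∣Y∣≡∣A∣) ∣H∣≤5^m (coset-length≤ X! X∼a)

  x₀ : Z5 (suc m)
  x₀ = proj₁ (<2*length⇒∃∈ X X-large)

  x₀∈X : x₀ ∈ X
  x₀∈X = proj₂ (<2*length⇒∃∈ X X-large)

  a∉H : ¬ H a
  a∉H Ha = large-coset⇒no-double X! X⊆A X∼a X-large (X⊆A x₀∈X)
             (∼-trans (X∼a x₀∈X) (∼-sym (∈⇒+∼ Ha)))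

  outside-±a : ∀ {c} → c ∈ A → ¬ c ∼ a → ¬ c ∼ ⊖ a → ⊥
  outside-±a {c} c∈A c≁a c≁-a =
    parts-exceed-fifth A-large ∣X∣+∣Y∣≡∣A∣ 5∣H∣≤5^m (coset-length≤ X! X∼a) (coset-length≤ Y! Y∼b)
    where
    open ∼-Reasoning

    c∈Y : c ∈ Y
    c∈Y = ∈-filter⁺ (∁? (_∼? a)) c∈A c≁a

    Y∼c : ∀ {y} → y ∈ Y → y ∼ c
    Y∼c y∈Y = ∼-trans (Y∼b y∈Y) (∼-sym (Y∼b c∈Y))

    c∉H+⟨a⟩ : ¬ (H +⟨ a ⟩) c
    c∉H+⟨a⟩ (fz , c∼𝟘) = large-coset⇒no-double Y! Y⊆A Y∼c Y-large c∈A (begin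
      c         ≡⟨ identityˡ c ⟨
      𝟘 ⊕ c     ≈⟨ ⊕-cong (∼-sym c∼𝟘) ∼-refl ⟩
      c ⊕ c     ∎)
    c∉H+⟨a⟩ (fs fz , c∼1·a) = c≁a (begin
      c         ≈⟨ c∼1·a ⟩
      1 · a     ≡⟨ identityʳ a ⟩
      a         ∎)
    c∉H+⟨a⟩ (fs (fs fz) , c∼2·a) = large-coset⇒no-double X! X⊆A X∼a X-large c∈A (begin
      c         ≈⟨ c∼2·a ⟩
      2 · a     ≡⟨ cong (a ⊕_) (identityʳ a) ⟩
      a ⊕ a     ∎)
    c∉H+⟨a⟩ (fs (fs (fs fz)) , c∼3·a) = large-coset⇒no-double Y! Y⊆A Y∼c Y-large (X⊆A x₀∈X) (begin
      x₀              ≈⟨ X∼a x₀∈X ⟩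
      a               ≡⟨ identityʳ a ⟨
      1 · a           ≡⟨ ·-mod-5 6 a ⟩
      6 · a           ≡⟨ ×-homo-+ a 3 3 ⟩
      3 · a ⊕ 3 · a   ≈⟨ ⊕-cong (∼-sym c∼3·a) (∼-sym c∼3·a) ⟩
      c ⊕ c           ∎)
    c∉H+⟨a⟩ (fs (fs (fs (fs fz))) , c∼4·a) = c≁-a (begin
      c         ≈⟨ c∼4·a ⟩
      4 · a     ≡⟨ ⊖≡4· a ⟨
      ⊖ a       ∎)

    5∣H∣≤5^m : 5 * ∣ H? ∣ ≤ 5 ^ m
    5∣H∣≤5^m = *-cancelˡ-≤ 5 (≤-trans (*-monoʳ-≤ 5 (+⟨⟩-size a∉H))
                                      (Coset.proper⇒5∣∣≤5^n +⟨ a ⟩? +⟨ a ⟩-isSubgroup c∉H+⟨a⟩))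

  in-±a : ∀ {x} → x ∈ A → x ∼ a ⊎ x ∼ ⊖ a
  in-±a {x} x∈A with x ∼? a | x ∼? (⊖ a)
  ... | yes x∼a | _        = inj₁ x∼a
  ... | no _    | yes x∼-a = inj₂ x∼-a
  ... | no x≁a  | no x≁-a  = ⊥-elim (outside-±a x∈A x≁a x≁-a)

lemma1 : (n : ℕ) → 1 ≤ n → (A : List (Z5 n)) → Unique A
    → (∀ x y z → x ∈ A → y ∈ A → z ∈ A → x ⊕ y ≢ z)
    → 3 * 5 ^ (n ∸ 1) < 2 * length A
    → (H : Z5 n → Set) → Decidable H → IsSubgroup H → IsProper H
    → (∃ λ a → ∃ λ b → ∀ x → x ∈ A → InCoset H a x ⊎ InCoset H b x)
    → ∃ λ e → ¬ H e × (∀ x → x ∈ A → InCoset H e x ⊎ InCoset H (⊖ e) x)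
lemma1 (suc m) _ A A! sum-free A-large H H? H-sub (g₀ , g₀∉H) (a , b , cover) =
  a , a∉H , λ _ → in-±a
  where open TwoCosets A! sum-free A-large H? H-sub g₀∉H cover
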